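{- For every WMST-instance $(G,\hat w,w)$ and every arrival order of the true weights, $\mathrm{GFtP}(\hat w,w)\le (1+2\varepsilon)\,\mathrm{Opt}(w)$, where $\varepsilon=\eta/\mathrm{Opt}(w)$; i.e., $\mathrm{cr}_{\mathrm{GFtP}}(\varepsilon)\le 1+2\varepsilon$.
   Context: A WMST-instance is a triple $(G,\hat w,w)$ with $G=(V,E)$ a finite simple connected undirected graph, $n=|V|$, $m=|E|$, and $\hat w,w\colon E\to\mathbb{R}^+$ predicted and true edge weights. The algorithm knows $G$ and $\hat w$ in advance; the true weights arrive one by one as pairs $(w(e),e)$, each edge once, and each edge must be irrevocably accepted or rejected upon arrival; accepted edges must form a spanning tree, whose cost is its total true weight. $\mathrm{Opt}(w)$ is the minimum true weight of a spanning tree. Error: with $p_e=|w(e)-\hat w(e)|$, $\eta$ is the sum of the $n-1$ largest values among $\{p_e\}_{e\in E}$, and $\varepsilon=\eta/\mathrm{Opt}(w)$. Algorithm GFtP: initially let $T$ be a minimum spanning tree of $G$ with respect to $\hat w$ and $U=E$. Upon arrival of $(w(e_i),e_i)$: set $U:=U\setminus\{e_i\}$. If $e_i\in T$, accept $e_i$. Otherwise let $C$ be the cycle that $e_i$ creates in $T\cup\{e_i\}$ and $C'=U\cap C$; if $C'\neq\emptyset$, let $e_{\max}$ be an edge of $C'$ of maximum $\hat w$; if $w(e_i)\le\hat w(e_{\max})$, set $T:=(T\setminus\{e_{\max}\})\cup\{e_i\}$ and accept $e_i$. Otherwise reject $e_i$. $\mathrm{GFtP}(\hat w,w)$ is the true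 weight of the final $T$.
   Formalization: The predicted and true edge weights $\hat w$ and $w$ take positive rational values rather than positive real ones. -}

module Defs where

open import Data.Nat as ℕ using (ℕ; _∸_)
open import Data.Fin using (Fin)
open import Data.Fin.Subset using (Subset; _∈_; _∉_; inside; outside)
open import Data.Vec using (lookup; _[_]≔_)
open import Data.List using (List; []; _∷_; allFin; map; foldr; take; reverse)
open import Data.List.Relation.Unary.Unique.Propositional using (Unique)
import Data.List.Membership.Propositional as LMem
open import Data.Product using (_×_; _,_; proj₁; proj₂; Σ; ∃; ∃-syntax)
open import Data.Sum using (_⊎_)
open import Data.Bool using (if_then_else_)
open import Relation.Binary.PropositionalEquality using (_≡_; _≢_)
open import Relation.Nullary using (¬_)
open import Data.Rational using (ℚ; 0ℚ; _+_; _-_; ∣_∣; _≤_; _<_)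
open import Data.Rational.Properties using (≤-decTotalOrder)
import Data.List.Sort as Sort

SameEnds : ∀ {n} → Fin n × Fin n → Fin n × Fin n → Set
SameEnds (a , b) (c , d) = (a ≡ c × b ≡ d) ⊎ (a ≡ d × b ≡ c)

record Graph (n m : ℕ) : Set where
  field
    ends   : Fin m → Fin n × Fin n
    noLoop : ∀ e → proj₁ (ends e) ≢ proj₂ (ends e)
    simple : ∀ e f → SameEnds (ends e) (ends f) → e ≡ f
open Graph public

module _ {n m : ℕ} (G : Graph n m) where

  Joins : Fin m → Fin n → Fin n → Set
  Joins e u x = SameEnds (ends G e) (u , x)

  data Walk (S : Subset m) : Fin n → Fin n → List (Fin n) → List (Fin m) → Set where
    stay : ∀ {u} → Walk S u u (u ∷ []) []
    step : ∀ {u x v vs es} (e : Fin m) → e ∈ S → Joins e u x →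
           Walk S x v vs es → Walk S u v (u ∷ vs) (e ∷ es)

  allEdges : Subset m
  allEdges = Data.Vec.replicate m inside

  Connected : Set
  Connected = ∀ u v → ∃[ vs ] ∃[ es ] Walk allEdges u v vs es

  HasCycle : Subset m → Set
  HasCycle S = ∃[ u ] ∃[ vs ] ∃[ es ] (Walk S u u vs es × Unique es × es ≢ [])

  SpanningTree : Subset m → Set
  SpanningTree S = (∀ u v → ∃[ vs ] ∃[ es ] Walk S u v vs es) × ¬ HasCycle S

  cost : (Fin m → ℚ) → Subset m → ℚ
  cost c S = foldr _+_ 0ℚ (map (λ e → if lookup S e then c e else 0ℚ) (allFin m))

  IsMinSpanningTree : (Fin m → ℚ) → Subset m → Set
  IsMinSpanningTree c S = SpanningTree S × (∀ S' → SpanningTree S' → cost c S ≤ cost c S')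

  eta : (ŵ w : Fin m → ℚ) → ℚ
  eta ŵ w = foldr _+_ 0ℚ (take (n ∸ 1) (reverse (Sort.sort ≤-decTotalOrder
              (map (λ e → ∣ w e - ŵ e ∣) (allFin m)))))

  -- Algorithm GFtP, as a relation describing all its possible runs
  -- (the initial MST and the choice of e_max among ties are arbitrary).  The set U of not-yet-arrived edges is the
  -- list  rest  of edges still to come after the current edge e.
  -- The cycle C created by e in T ∪ {e} is e together with the edges es
  -- of a (simple) path in T between the endpoints of e; since e ∉ U,
  -- C' = U ∩ C consists of the edges of es that occur in rest.

  open LMem using () renaming (_∈_ to _∈ˡ_)

  TreePath : Subset m → Fin m → List (Fin n) → List (Fin m) → Set
  TreePath T e vs es = Walk T (proj₁ (ends G e)) (proj₂ (ends G e)) vs es × Unique vs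

  IsMaxOfC' : (ŵ : Fin m → ℚ) → List (Fin m) → List (Fin m) → Fin m → Set
  IsMaxOfC' ŵ rest es emax =
    emax ∈ˡ es × emax ∈ˡ rest × (∀ f → f ∈ˡ es → f ∈ˡ rest → ŵ f ≤ ŵ emax)

  data Step (ŵ w : Fin m → ℚ) (T : Subset m) (rest : List (Fin m)) (e : Fin m)
       : Subset m → Set where
    accept-tree : e ∈ T → Step ŵ w T rest e T
    accept-swap : ∀ {vs es} emax → e ∉ T → TreePath T e vs es →
                  IsMaxOfC' ŵ rest es emax → w e ≤ ŵ emax →
                  Step ŵ w T rest e ((T [ emax ]≔ outside) [ e ]≔ inside)
    reject-empty : ∀ {vs es} → e ∉ T → TreePath T e vs es →
                   (∀ f → f ∈ˡ es → ¬ (f ∈ˡ rest)) → Step ŵ w T rest e T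
    reject-heavy : ∀ {vs es} emax → e ∉ T → TreePath T e vs es →
                   IsMaxOfC' ŵ rest es emax → ŵ emax < w e → Step ŵ w T rest e T

  data Run (ŵ w : Fin m → ℚ) : Subset m → List (Fin m) → Subset m → Set where
    done : ∀ {T} → Run ŵ w T [] T
    next : ∀ {T T' T'' e rest} → Step ŵ w T rest e T' →
           Run ŵ w T' rest T'' → Run ŵ w T (e ∷ rest) T''

-- Charge every edge that has not arrived yet its predicted weight plus its error,
-- ŵ e + ∣ w e - ŵ e ∣ ≥ w e, and every arrived edge its true weight.  Under these
-- charges the weight of GFtP's current tree never increases: an accepted tree edge
-- trades ŵ e + ∣ w e - ŵ e ∣ for w e, and a swap replaces the pending e_max, charged
-- at least ŵ e_max, by the arrived e with w e ≤ ŵ e_max.  Hence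
--   w(T) ≤ ŵ(T₀) + err(T₀) ≤ ŵ(Tₒ) + err(T₀) ≤ w(Tₒ) + err(Tₒ) + err(T₀),
-- where err(S) sums ∣ w e - ŵ e ∣ over S.  A forest has at most n ∸ 1 edges, so each
-- error sum is at most η, the sum of the n ∸ 1 largest errors.

{-# OPTIONS --safe #-}
module Submission where

open import Defs
open import Algebra.Bundles using (CommutativeMonoid)
open import Data.Bool using (Bool; true; false; if_then_else_)
open import Data.Bool.Properties using (T-≡)
open import Data.Empty using (⊥; ⊥-elim)
open import Data.Fin using (Fin; zero; suc)
open import Data.Fin.Properties using (_≟_)
open import Data.Fin.Subset using (Subset; inside; outside; _∈_; _∉_; _⊆_) renaming (_-_ to _-ˢ_; ∣_∣ to ∣_∣ˢ)
open import Data.Fin.Subset.Properties using (∣p∣≤n; p⊆q⇒∣p∣≤∣q∣; x∈p⇒∣p-x∣<∣p∣; x∈p∧x∉q⇒x∈p─q; x≢y⇒x∉⁅y⁆)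
open import Data.List using (List; []; _∷_; _++_; map; foldr; filter; take; reverse; allFin; length; tabulate)
open import Data.List.Properties using (map-tabulate; unfold-reverse)
import Data.List.Membership.DecPropositional as DecMembership
open import Data.List.Membership.Propositional using () renaming (_∈_ to _∈ₗ_; _∉_ to _∉ₗ_)
open import Data.List.Relation.Binary.Permutation.Propositional using (_↭_; ↭-sym; ↭-trans; ↭⇒↭ₛ)
open import Data.List.Relation.Binary.Permutation.Propositional.Properties
  using (↭-map-inv; ↭-reverse; ↭-length; filter-↭; map⁺; All-resp-↭)
import Data.List.Relation.Binary.Permutation.Setoid.Properties as Permutation
open import Data.List.Relation.Binary.Subset.Propositional using () renaming (_⊆_ to _⊆ₗ_)
open import Data.List.Relation.Binary.Subset.Propositional.Properties using (xs⊆x∷xs; ∷⁺ʳ)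
open import Data.List.Relation.Unary.All as All using (All; []; _∷_)
open import Data.List.Relation.Unary.All.Properties using (++⁺; ¬Any⇒All¬; all-filter)
open import Data.List.Relation.Unary.AllPairs using (AllPairs; []; _∷_)
import Data.List.Relation.Unary.AllPairs.Properties as AllPairs
open import Data.List.Relation.Unary.Any using (here; there; any?)
open import Data.List.Relation.Unary.Linked.Properties using (Linked⇒AllPairs)
open import Data.List.Relation.Unary.Unique.Propositional using (Unique)
open import Data.List.Relation.Unary.Unique.Propositional.Properties using (allFin⁺; filter⁺)
open import Data.Nat as ℕ using (ℕ; zero; suc; _∸_; z≤n; s≤s; s≤s⁻¹)
import Data.Nat.Properties as ℕ
open import Data.Product using (_×_; _,_; proj₁; proj₂; ∃-syntax)
open import Data.Rational using (ℚ; Positive; 0ℚ; 1ℚ; _+_; _*_; _-_; -_; ∣_∣; _≤_; _≥_)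
open import Data.Rational.Properties
  using ( ≤-refl; ≤-reflexive; ≤-trans; ≤-total; ≤-decTotalOrder; +-identityˡ; +-identityʳ
        ; +-mono-≤; +-monoˡ-≤; +-monoʳ-≤; 0≤∣p∣; 0≤p⇒∣p∣≡p; ∣-p∣≡∣p∣
        ; +-0-isCommutativeMonoid; +-0-commutativeMonoid; module ≤-Reasoning )
open import Data.Rational.Solver using (module +-*-Solver)
open import Data.Sum using (_⊎_; inj₁; inj₂)
open import Data.Vec using (_∷_; lookup; _[_]≔_; here; there) renaming ([] to [])
import Data.Vec as Vec
open import Data.Vec.Properties using (lookup⇒[]=; []=⇒lookup; lookup∘tabulate)
open import Function using (_∘_; id; flip; Equivalence)
open import Level using (0ℓ)
open import Relation.Binary.PropositionalEquality
  using (_≡_; _≢_; refl; sym; trans; cong; cong₂; subst; setoid; module ≡-Reasoning)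
open import Relation.Nullary using (¬_; yes; no)
open import Relation.Nullary.Decidable using (does; T?; dec-true; dec-false)
open import Relation.Unary using (Pred; Decidable)

open import Algebra.Properties.CommutativeSemigroup (CommutativeMonoid.commutativeSemigroup +-0-commutativeMonoid)
  using (x∙yz≈y∙xz; interchange)
open import Data.List.Sort ≤-decTotalOrder using (sort; sort-↭; sort-↗)

p≤∣p∣ : ∀ p → p ≤ ∣ p ∣
p≤∣p∣ p with ≤-total 0ℚ p
... | inj₁ 0≤p = ≤-reflexive (sym (0≤p⇒∣p∣≡p 0≤p))
... | inj₂ p≤0 = ≤-trans p≤0 (0≤∣p∣ p)

x≤y+∣x-y∣ : ∀ x y → x ≤ y + ∣ x - y ∣
x≤y+∣x-y∣ x y = begin
  x             ≡⟨ solve 2 (λ x y → x := y :+ (x :- y)) refl x y ⟩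
  y + (x - y)   ≤⟨ +-monoʳ-≤ y (p≤∣p∣ (x - y)) ⟩
  y + ∣ x - y ∣ ∎
  where
  open ≤-Reasoning
  open +-*-Solver

y≤x+∣x-y∣ : ∀ x y → y ≤ x + ∣ x - y ∣
y≤x+∣x-y∣ x y = begin
  y                 ≡⟨ solve 2 (λ x y → y := x :+ (:- (x :- y))) refl x y ⟩
  x + - (x - y)     ≤⟨ +-monoʳ-≤ x (p≤∣p∣ (- (x - y))) ⟩
  x + ∣ - (x - y) ∣ ≡⟨ cong (x +_) (∣-p∣≡∣p∣ (x - y)) ⟩
  x + ∣ x - y ∣     ∎
  where
  open ≤-Reasoning
  open +-*-Solver

-- Sums of the largest values

sum : List ℚ → ℚ
sum = foldr _+_ 0ℚ

sum-↭ : ∀ {xs ys} → xs ↭ ys → sum xs ≡ sum ys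
sum-↭ xs↭ys = Permutation.foldr-commMonoid (setoid ℚ) +-0-isCommutativeMonoid (↭⇒↭ₛ xs↭ys)

sum-if≡sum-filter : ∀ {A : Set} (b : A → Bool) (c : A → ℚ) xs →
  sum (map (λ x → if b x then c x else 0ℚ) xs) ≡ sum (map c (filter (T? ∘ b) xs))
sum-if≡sum-filter b c []       = refl
sum-if≡sum-filter b c (x ∷ xs) with b x
... | true  = cong (c x +_) (sum-if≡sum-filter b c xs)
... | false = trans (+-identityˡ _) (sum-if≡sum-filter b c xs)

AllPairs-reverse : ∀ {A : Set} {R : A → A → Set} {xs} → AllPairs R xs → AllPairs (flip R) (reverse xs)
AllPairs-reverse {xs = []}     []         = []
AllPairs-reverse {xs = x ∷ xs} (Rx ∷ Rxs) rewrite unfold-reverse x xs =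
  AllPairs.++⁺ (AllPairs-reverse Rxs) ([] ∷ []) (All.map (_∷ []) (All-resp-↭ (↭-sym (↭-reverse xs)) Rx))

sum-take-suc≤ : ∀ {y} k ys → 0ℚ ≤ y → All (_≤ y) ys → sum (take (suc k) ys) ≤ y + sum (take k ys)
sum-take-suc≤ {y} zero    []       0≤y _          = ≤-trans 0≤y (≤-reflexive (sym (+-identityʳ y)))
sum-take-suc≤ {y} (suc k) []       0≤y _          = ≤-trans 0≤y (≤-reflexive (sym (+-identityʳ y)))
sum-take-suc≤     zero    (z ∷ zs) _   (z≤y ∷ _)  = +-monoˡ-≤ 0ℚ z≤y
sum-take-suc≤ {y} (suc k) (z ∷ zs) 0≤y (_ ∷ zs≤y) = begin
  z + sum (take (suc k) zs)  ≤⟨ +-monoʳ-≤ z (sum-take-suc≤ k zs 0≤y zs≤y) ⟩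
  z + (y + sum (take k zs))  ≡⟨ x∙yz≈y∙xz z y _ ⟩
  y + (z + sum (take k zs))  ∎
  where open ≤-Reasoning

module _ {A : Set} (c : A → ℚ) (0≤c : ∀ x → 0ℚ ≤ c x) {P : Pred A 0ℓ} (P? : Decidable P) where

  sum-filter≤sum-take : ∀ k xs → AllPairs _≥_ (map c xs) → length (filter P? xs) ℕ.≤ k →
                        sum (map c (filter P? xs)) ≤ sum (take k (map c xs))
  sum-filter≤sum-take zero    []       _ _ = ≤-refl
  sum-filter≤sum-take (suc k) []       _ _ = ≤-refl
  sum-filter≤sum-take k       (x ∷ xs) (_ ∷ descending) len with does (P? x)
  sum-filter≤sum-take (suc k) (x ∷ xs) (_ ∷ descending) len | true =
    +-monoʳ-≤ (c x) (sum-filter≤sum-take k xs descending (s≤s⁻¹ len))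
  sum-filter≤sum-take zero    (x ∷ xs) (_ ∷ descending) len | false =
    sum-filter≤sum-take zero xs descending len
  sum-filter≤sum-take (suc k) (x ∷ xs) (xs≤x ∷ descending) len | false =
    ≤-trans (sum-filter≤sum-take (suc k) xs descending len) (sum-take-suc≤ k (map c xs) (0≤c x) xs≤x)

  sum-filter≤sum-largest : ∀ k xs → length (filter P? xs) ℕ.≤ k →
                           sum (map c (filter P? xs)) ≤ sum (take k (reverse (sort (map c xs))))
  sum-filter≤sum-largest k xs len
    with ys , sorted≡ , xs↭ys ← ↭-map-inv c (↭-sym (↭-trans (↭-reverse _) (sort-↭ (map c xs)))) = begin
      sum (map c (filter P? xs))               ≡⟨ sum-↭ (map⁺ c (filter-↭ P? xs↭ys)) ⟩
      sum (map c (filter P? ys))               ≤⟨ sum-filter≤sum-take k ys descending len′ ⟩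
      sum (take k (map c ys))                  ≡⟨ cong (sum ∘ take k) sorted≡ ⟨
      sum (take k (reverse (sort (map c xs)))) ∎
    where
    open ≤-Reasoning
    descending : AllPairs _≥_ (map c ys)
    descending = subst (AllPairs _≥_) sorted≡ (AllPairs-reverse (Linked⇒AllPairs ≤-trans (sort-↗ (map c xs))))
    len′ : length (filter P? ys) ℕ.≤ k
    len′ = subst (ℕ._≤ k) (↭-length (filter-↭ P? xs↭ys)) len

weight : ∀ {k} → (Fin k → ℚ) → Subset k → ℚ
weight c []            = 0ℚ
weight c (outside ∷ S) = weight (c ∘ suc) S
weight c (inside  ∷ S) = c zero + weight (c ∘ suc) S

-- The right-hand side is what `cost G c S` unfolds to.
weight≡sum : ∀ {k} (c : Fin k → ℚ) S →
             weight c S ≡ sum (map (λ e → if lookup S e then c e else 0ℚ) (allFin k))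
weight≡sum c []      = refl
weight≡sum {suc k} c (b ∷ S) = begin
  weight c (b ∷ S)                          ≡⟨ head+tail b ⟩
  c₀ + weight (c ∘ suc) S                   ≡⟨ cong (c₀ +_) (weight≡sum (c ∘ suc) S) ⟩
  c₀ + sum (map (summand ∘ suc) (allFin k)) ≡⟨ cong (λ xs → c₀ + sum xs) tail≡ ⟨
  c₀ + sum (map summand (tabulate suc))     ∎
  where
  open ≡-Reasoning
  summand : Fin (suc k) → ℚ
  summand e = if lookup (b ∷ S) e then c e else 0ℚ
  c₀ : ℚ
  c₀ = summand zero
  head+tail : ∀ b′ → weight c (b′ ∷ S) ≡ (if b′ then c zero else 0ℚ) + weight (c ∘ suc) S
  head+tail inside  = refl
  head+tail outside = sym (+-identityˡ _)
  tail≡ : map summand (tabulate suc) ≡ map (summand ∘ suc) (allFin k)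
  tail≡ = trans (map-tabulate suc summand) (sym (map-tabulate id (summand ∘ suc)))

weight-mono : ∀ {k} {c d : Fin k → ℚ} → (∀ x → c x ≤ d x) → ∀ S → weight c S ≤ weight d S
weight-mono c≤d []            = ≤-refl
weight-mono c≤d (outside ∷ S) = weight-mono (c≤d ∘ suc) S
weight-mono c≤d (inside  ∷ S) = +-mono-≤ (c≤d zero) (weight-mono (c≤d ∘ suc) S)

weight-+ : ∀ {k} (c d : Fin k → ℚ) S → weight (λ x → c x + d x) S ≡ weight c S + weight d S
weight-+ c d []            = sym (+-identityʳ 0ℚ)
weight-+ c d (outside ∷ S) = weight-+ (c ∘ suc) (d ∘ suc) S
weight-+ c d (inside  ∷ S) = trans (cong (c zero + d zero +_) (weight-+ (c ∘ suc) (d ∘ suc) S))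
                                   (interchange (c zero) (d zero) (weight (c ∘ suc) S) (weight (d ∘ suc) S))

weight-insert : ∀ {k} (c : Fin k → ℚ) {x S} → x ∉ S → weight c (S [ x ]≔ inside) ≡ c x + weight c S
weight-insert c {zero}  {outside ∷ S} _   = refl
weight-insert c {zero}  {inside  ∷ S} x∉S = ⊥-elim (x∉S here)
weight-insert c {suc x} {outside ∷ S} x∉S = weight-insert (c ∘ suc) (x∉S ∘ there)
weight-insert c {suc x} {inside  ∷ S} x∉S =
  trans (cong (c zero +_) (weight-insert (c ∘ suc) (x∉S ∘ there))) (x∙yz≈y∙xz (c zero) (c (suc x)) _)

weight-remove : ∀ {k} (c : Fin k → ℚ) {x S} → x ∈ S → weight c S ≡ c x + weight c (S [ x ]≔ outside)
weight-remove c {zero}  here                       = refl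
weight-remove c {suc x} {outside ∷ S} (there x∈S) = weight-remove (c ∘ suc) x∈S
weight-remove c {suc x} {inside  ∷ S} (there x∈S) =
  trans (cong (c zero +_) (weight-remove (c ∘ suc) x∈S)) (x∙yz≈y∙xz (c zero) (c (suc x)) _)

[]≔outside⊆ : ∀ {k} (S : Subset k) x → S [ x ]≔ outside ⊆ S
[]≔outside⊆ (_ ∷ S) zero    (there y∈S) = there y∈S
[]≔outside⊆ (_ ∷ S) (suc x) here        = here
[]≔outside⊆ (_ ∷ S) (suc x) (there y∈S) = there ([]≔outside⊆ S x y∈S)

-- Walks, paths and forests

module _ {n m : ℕ} (G : Graph n m) where

  end₁ end₂ : Fin m → Fin n
  end₁ e = proj₁ (ends G e)
  end₂ e = proj₂ (ends G e)

  private variable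
    S : Subset m
    u v x : Fin n
    e f : Fin m
    vs : List (Fin n)
    es L : List (Fin m)

  joins-end : Joins G e u x → u ≡ end₁ e ⊎ u ≡ end₂ e
  joins-end (inj₁ (refl , _)) = inj₁ refl
  joins-end (inj₂ (_ , refl)) = inj₂ refl

  walk-edge∈ : Walk G S u v vs es → f ∈ₗ es → f ∈ S
  walk-edge∈ (step _ e∈S _ _) (here refl)  = e∈S
  walk-edge∈ (step _ _   _ w) (there f∈es) = walk-edge∈ w f∈es

  walk-start∈ : Walk G S u v vs es → u ∈ₗ vs
  walk-start∈ stay           = here refl
  walk-start∈ (step _ _ _ _) = here refl

  walk-ends∈ : Walk G S u v vs es → f ∈ₗ es → end₁ f ∈ₗ vs × end₂ f ∈ₗ vs
  walk-ends∈ (step _ _ (inj₁ (refl , refl)) w) (here refl) = here refl , there (walk-start∈ w)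
  walk-ends∈ (step _ _ (inj₂ (refl , refl)) w) (here refl) = there (walk-start∈ w) , here refl
  walk-ends∈ (step _ _ _ w) (there f∈es) with a∈ , b∈ ← walk-ends∈ w f∈es = there a∈ , there b∈

  walk-++ : ∀ {vs′ es′} → Walk G S u v vs es → Walk G S v x vs′ es′ →
            ∃[ vs″ ] Walk G S u x vs″ (es ++ es′)
  walk-++ stay             w′ = _ , w′
  walk-++ (step e e∈S j w) w′ with _ , w″ ← walk-++ w w′ = _ , step e e∈S j w″

  path-edges-unique : Walk G S u v vs es → Unique vs → Unique es
  path-edges-unique stay           _             = []
  path-edges-unique (step e _ j w) (u∉vs ∷ uniq) = All.tabulate e≢ ∷ path-edges-unique w uniq
    where
    e≢ : f ∈ₗ _ → e ≢ f
    e≢ f∈es refl with walk-ends∈ w f∈es | joins-end j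
    ... | a∈ , _ | inj₁ refl = All.lookup u∉vs a∈ refl
    ... | _ , b∈ | inj₂ refl = All.lookup u∉vs b∈ refl

  PathWithin : Subset m → Fin n → Fin n → List (Fin m) → Set
  PathWithin S u v es = ∃[ vs′ ] ∃[ es′ ] (Walk G S u v vs′ es′ × Unique vs′ × es′ ⊆ₗ es)

  path-suffix : Walk G S x v vs es → Unique vs → u ∈ₗ vs → PathWithin S u v es
  path-suffix stay             uniq       (here refl)  = _ , _ , stay , uniq , id
  path-suffix w@(step _ _ _ _) uniq       (here refl)  = _ , _ , w , uniq , id
  path-suffix (step _ _ _ w)   (_ ∷ uniq) (there u∈vs)
    with vs′ , es′ , p , uniq′ , sub ← path-suffix w uniq u∈vs = vs′ , es′ , p , uniq′ , there ∘ sub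

  walk⇒path : Walk G S u v vs es → PathWithin S u v es
  walk⇒path stay = _ , _ , stay , [] ∷ [] , id
  walk⇒path {u = u} (step e e∈S j w) with vs′ , es′ , p , uniq , sub ← walk⇒path w | any? (u ≟_) vs′
  ... | yes u∈vs′ with vs″ , es″ , p′ , uniq′ , sub′ ← path-suffix p uniq u∈vs′ =
    vs″ , es″ , p′ , uniq′ , there ∘ sub ∘ sub′
  ... | no  u∉vs′ = _ , _ , step e e∈S j p , ¬Any⇒All¬ vs′ u∉vs′ ∷ uniq , ∷⁺ʳ e sub

  acyclic⇒bridge : ¬ HasCycle G S → e ∈ S → Walk G S (end₂ e) (end₁ e) vs es → e ∉ₗ es → ⊥
  acyclic⇒bridge {e = e} acyclic e∈S w e∉es with vs′ , es′ , p , uniq , sub ← walk⇒path w =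
    acyclic (end₁ e , end₁ e ∷ vs′ , e ∷ es′ , step e e∈S (inj₁ (refl , refl)) p ,
             All.tabulate (λ { f∈es′ refl → e∉es (sub f∈es′) }) ∷ path-edges-unique p uniq , λ ())

  Joined : Subset m → List (Fin m) → Fin n → Fin n → Set
  Joined S L u v = ∃[ vs ] ∃[ es ] (Walk G S u v vs es × All (_∈ₗ L) es)

  joined-refl : Joined S L u u
  joined-refl = _ , _ , stay , []

  joined-trans : Joined S L u v → Joined S L v x → Joined S L u x
  joined-trans (_ , es , w , es⊆L) (_ , es′ , w′ , es′⊆L) with _ , w″ ← walk-++ w w′ =
    _ , es ++ es′ , w″ , ++⁺ es⊆L es′⊆L

  joined-∷ : Joined S L u v → Joined S (e ∷ L) u v
  joined-∷ (_ , _ , w , es⊆L) = _ , _ , w , All.map there es⊆L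

  joined-edge : e ∈ S → Joined S (e ∷ L) (end₁ e) (end₂ e)
  joined-edge {e = e} e∈S = _ , _ , step e e∈S (inj₁ (refl , refl)) stay , here refl ∷ []

  joined-edge⁻¹ : e ∈ S → Joined S (e ∷ L) (end₂ e) (end₁ e)
  joined-edge⁻¹ {e = e} e∈S = _ , _ , step e e∈S (inj₂ (refl , refl)) stay , here refl ∷ []

  -- Union–find: the classes of rep L are the components of the subgraph with edge set L.
  rep : List (Fin m) → Fin n → Fin n
  rep []      u = u
  rep (e ∷ L) u = if does (rep L u ≟ rep L (end₂ e)) then rep L (end₁ e) else rep L u

  rep-∷-≡ : ∀ e L u → rep L u ≡ rep L (end₂ e) → rep (e ∷ L) u ≡ rep L (end₁ e)
  rep-∷-≡ e L u eq rewrite dec-true (rep L u ≟ rep L (end₂ e)) eq = refl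

  rep-∷-≢ : ∀ e L u → rep L u ≢ rep L (end₂ e) → rep (e ∷ L) u ≡ rep L u
  rep-∷-≢ e L u ne rewrite dec-false (rep L u ≟ rep L (end₂ e)) ne = refl

  rep-idem : ∀ L u → rep L (rep L u) ≡ rep L u
  rep-idem []      u = refl
  rep-idem (e ∷ L) u with rep L u ≟ rep L (end₂ e)
  ... | yes _ with rep L (end₁ e) ≟ rep L (end₂ e)
  ...   | yes a~b = rep-∷-≡ e L (rep L (end₁ e)) (trans (rep-idem L (end₁ e)) a~b)
  ...   | no  a≁b = trans (rep-∷-≢ e L (rep L (end₁ e)) (a≁b ∘ trans (sym (rep-idem L (end₁ e)))))
                          (rep-idem L (end₁ e))
  rep-idem (e ∷ L) u | no u≁b =
    trans (rep-∷-≢ e L (rep L u) (u≁b ∘ trans (sym (rep-idem L u)))) (rep-idem L u)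

  rep-joined : All (_∈ S) L → rep L u ≡ rep L v → Joined S L u v
  rep-joined {L = []}    _            refl = joined-refl
  rep-joined {L = e ∷ L} {u} {v} (e∈S ∷ L⊆S) eq
    with rep L u ≟ rep L (end₂ e) | rep L v ≟ rep L (end₂ e)
  ... | yes u~b | yes v~b = joined-∷ (rep-joined L⊆S (trans u~b (sym v~b)))
  ... | yes u~b | no  _   = joined-trans (joined-∷ (rep-joined L⊆S u~b))
                              (joined-trans (joined-edge⁻¹ e∈S) (joined-∷ (rep-joined L⊆S eq)))
  ... | no  _   | yes v~b = joined-trans (joined-∷ (rep-joined L⊆S eq))
                              (joined-trans (joined-edge e∈S) (joined-∷ (rep-joined L⊆S (sym v~b))))
  ... | no  _   | no  _   = joined-∷ (rep-joined L⊆S eq)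

  roots : List (Fin m) → Subset n
  roots L = Vec.tabulate (λ u → does (rep L u ≟ u))

  lookup-roots : ∀ L u → lookup (roots L) u ≡ does (rep L u ≟ u)
  lookup-roots L u = lookup∘tabulate (λ u → does (rep L u ≟ u)) u

  ∈-roots⁺ : ∀ L → rep L u ≡ u → u ∈ roots L
  ∈-roots⁺ {u} L eq = lookup⇒[]= u (roots L) (trans (lookup-roots L u) (dec-true (rep L u ≟ u) eq))

  ∈-roots⁻ : ∀ L → u ∈ roots L → rep L u ≡ u
  ∈-roots⁻ {u} L u∈ with rep L u ≟ u | trans (sym (lookup-roots L u)) ([]=⇒lookup u∈)
  ... | yes eq | _  = eq
  ... | no  _  | ()

  roots-∷⊆ : ∀ e L → rep L (end₁ e) ≢ rep L (end₂ e) → roots (e ∷ L) ⊆ roots L -ˢ rep L (end₂ e)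
  roots-∷⊆ e L a≁b {u} u∈ = x∈p∧x∉q⇒x∈p─q (∈-roots⁺ L (proj₁ root)) (x≢y⇒x∉⁅y⁆ (proj₂ root))
    where
    fixed : rep (e ∷ L) u ≡ u
    fixed = ∈-roots⁻ (e ∷ L) u∈
    root : rep L u ≡ u × u ≢ rep L (end₂ e)
    root with rep L u ≟ rep L (end₂ e)
    ... | yes u~b = let a≡u = trans (sym (rep-∷-≡ e L u u~b)) fixed in
                    trans (cong (rep L) (sym a≡u)) (trans (rep-idem L (end₁ e)) a≡u) ,
                    λ u≡b → a≁b (trans a≡u u≡b)
    ... | no  u≁b = let rep≡u = trans (sym (rep-∷-≢ e L u u≁b)) fixed in
                    rep≡u , λ u≡b → u≁b (trans rep≡u u≡b)

  -- In a forest every edge joins two different classes, so each edge removes a root.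
  forest-size+roots : ¬ HasCycle G S → ∀ L → Unique L → All (_∈ S) L →
                      length L ℕ.+ ∣ roots L ∣ˢ ℕ.≤ n
  forest-size+roots acyclic []      _            _           = ∣p∣≤n (roots [])
  forest-size+roots acyclic (e ∷ L) (e∉L ∷ uniq) (e∈S ∷ L⊆S) = begin
    suc (length L ℕ.+ ∣ roots (e ∷ L) ∣ˢ)  ≡⟨ ℕ.+-suc (length L) _ ⟨
    length L ℕ.+ suc ∣ roots (e ∷ L) ∣ˢ    ≤⟨ ℕ.+-monoʳ-≤ (length L) fewer-roots ⟩
    length L ℕ.+ ∣ roots L ∣ˢ              ≤⟨ forest-size+roots acyclic L uniq L⊆S ⟩
    n                                      ∎
    where
    open ℕ.≤-Reasoning
    a≁b : rep L (end₁ e) ≢ rep L (end₂ e)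
    a≁b a~b with _ , _ , w , es⊆L ← rep-joined L⊆S (sym a~b) =
      acyclic⇒bridge acyclic e∈S w (λ e∈es → All.lookup e∉L (All.lookup es⊆L e∈es) refl)
    fewer-roots : suc ∣ roots (e ∷ L) ∣ˢ ℕ.≤ ∣ roots L ∣ˢ
    fewer-roots = ℕ.≤-trans (s≤s (p⊆q⇒∣p∣≤∣q∣ (roots-∷⊆ e L a≁b)))
                            (x∈p⇒∣p-x∣<∣p∣ (∈-roots⁺ L (rep-idem L (end₂ e))))

  forest-size : ¬ HasCycle G S → ∀ L → Unique L → All (_∈ S) L → length L ℕ.≤ n ∸ 1
  forest-size acyclic []      _    _    = z≤n
  forest-size acyclic (e ∷ L) uniq L⊆S = begin
    length (e ∷ L)          ≤⟨ ℕ.m+n≤o⇒m≤o∸n _ (forest-size+roots acyclic (e ∷ L) uniq L⊆S) ⟩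
    n ∸ ∣ roots (e ∷ L) ∣ˢ  ≤⟨ ℕ.∸-monoʳ-≤ n (ℕ.≤-trans (s≤s z≤n) (x∈p⇒∣p-x∣<∣p∣ a∈roots)) ⟩
    n ∸ 1                   ∎
    where
    open ℕ.≤-Reasoning
    a∈roots : rep (e ∷ L) (end₁ e) ∈ roots (e ∷ L)
    a∈roots = ∈-roots⁺ (e ∷ L) (rep-idem (e ∷ L) (end₁ e))

  acyclic-size : ¬ HasCycle G S → length (filter (T? ∘ lookup S) (allFin m)) ℕ.≤ n ∸ 1
  acyclic-size {S} acyclic = forest-size acyclic _ (filter⁺ (T? ∘ lookup S) (allFin⁺ m))
    (All.map (λ {e} → lookup⇒[]= e S ∘ Equivalence.to T-≡) (all-filter (T? ∘ lookup S) (allFin m)))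

-- The potential of GFtP

module _ {n m : ℕ} (G : Graph n m) (ŵ w : Fin m → ℚ) where

  open DecMembership (_≟_ {m}) using () renaming (_∈?_ to _∈ₗ?_)
  open ≤-Reasoning

  err : Fin m → ℚ
  err e = ∣ w e - ŵ e ∣

  cost-err≤eta : ∀ {S} → ¬ HasCycle G S → cost G err S ≤ eta G ŵ w
  cost-err≤eta {S} acyclic = begin
    cost G err S                                      ≡⟨ sum-if≡sum-filter (lookup S) err (allFin m) ⟩
    sum (map err (filter (T? ∘ lookup S) (allFin m))) ≤⟨ sum-filter≤sum-largest err (λ e → 0≤∣p∣ (w e - ŵ e))
                                                            (T? ∘ lookup S) _ _ (acyclic-size G acyclic) ⟩
    eta G ŵ w                                         ∎

  cost-ŵ≤cost-w+err : ∀ S → cost G ŵ S ≤ cost G w S + cost G err S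
  cost-ŵ≤cost-w+err S = begin
    cost G ŵ S                   ≡⟨ weight≡sum ŵ S ⟨
    weight ŵ S                   ≤⟨ weight-mono (λ e → y≤x+∣x-y∣ (w e) (ŵ e)) S ⟩
    weight (λ e → w e + err e) S ≡⟨ weight-+ w err S ⟩
    weight w S + weight err S    ≡⟨ cong₂ _+_ (weight≡sum w S) (weight≡sum err S) ⟩
    cost G w S + cost G err S    ∎

  w⁺ : List (Fin m) → Fin m → ℚ
  w⁺ pending e = if does (e ∈ₗ? pending) then ŵ e + err e else w e

  w⁺≤ŵ+err : ∀ pending e → w⁺ pending e ≤ ŵ e + err e
  w⁺≤ŵ+err pending e with e ∈ₗ? pending
  ... | yes _ = ≤-refl
  ... | no  _ = x≤y+∣x-y∣ (w e) (ŵ e)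

  w⁺-mono : ∀ {pending pending′} → pending ⊆ₗ pending′ → ∀ e → w⁺ pending e ≤ w⁺ pending′ e
  w⁺-mono {pending} {pending′} sub e with e ∈ₗ? pending | e ∈ₗ? pending′
  ... | yes _  | yes _  = ≤-refl
  ... | yes e∈ | no  e∉ = ⊥-elim (e∉ (sub e∈))
  ... | no  _  | yes _  = x≤y+∣x-y∣ (w e) (ŵ e)
  ... | no  _  | no  _  = ≤-refl

  w⁺-arrived : ∀ {pending e} → e ∉ₗ pending → w⁺ pending e ≡ w e
  w⁺-arrived {pending} {e} e∉ rewrite dec-false (e ∈ₗ? pending) e∉ = refl

  w⁺-pending : ∀ {pending e} → e ∈ₗ pending → w⁺ pending e ≡ ŵ e + err e
  w⁺-pending {pending} {e} e∈ rewrite dec-true (e ∈ₗ? pending) e∈ = refl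

  weight-arrival-≤ : ∀ rest e T → weight (w⁺ rest) T ≤ weight (w⁺ (e ∷ rest)) T
  weight-arrival-≤ rest e = weight-mono (w⁺-mono (xs⊆x∷xs rest e))

  step-weight-≤ : ∀ {T T′ rest e} → e ∉ₗ rest → Step G ŵ w T rest e T′ →
                  weight (w⁺ rest) T′ ≤ weight (w⁺ (e ∷ rest)) T
  step-weight-≤ {T} {rest = rest} {e} _ (accept-tree _)          = weight-arrival-≤ rest e T
  step-weight-≤ {T} {rest = rest} {e} _ (reject-empty _ _ _)     = weight-arrival-≤ rest e T
  step-weight-≤ {T} {rest = rest} {e} _ (reject-heavy _ _ _ _ _) = weight-arrival-≤ rest e T
  step-weight-≤ {T} {rest = rest} {e} e∉rest
                (accept-swap emax e∉T (path , _) (emax∈es , emax∈rest , _) we≤ŵemax) = begin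
      weight (w⁺ rest) (T′ [ e ]≔ inside)
        ≡⟨ weight-insert (w⁺ rest) (e∉T ∘ []≔outside⊆ T emax) ⟩
      w⁺ rest e + weight (w⁺ rest) T′
        ≤⟨ +-mono-≤ e-cheaper (weight-arrival-≤ rest e T′) ⟩
      w⁺ (e ∷ rest) emax + weight (w⁺ (e ∷ rest)) T′
        ≡⟨ weight-remove (w⁺ (e ∷ rest)) (walk-edge∈ G path emax∈es) ⟨
      weight (w⁺ (e ∷ rest)) T
        ∎
    where
    T′ : Subset m
    T′ = T [ emax ]≔ outside
    e-cheaper : w⁺ rest e ≤ w⁺ (e ∷ rest) emax
    e-cheaper = begin
      w⁺ rest e           ≡⟨ w⁺-arrived e∉rest ⟩
      w e                 ≤⟨ we≤ŵemax ⟩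
      ŵ emax              ≡⟨ +-identityʳ (ŵ emax) ⟨
      ŵ emax + 0ℚ         ≤⟨ +-monoʳ-≤ (ŵ emax) (0≤∣p∣ _) ⟩
      ŵ emax + err emax   ≡⟨ w⁺-pending (there emax∈rest) ⟨
      w⁺ (e ∷ rest) emax  ∎

  run-weight-≤ : ∀ {T T′ order} → Unique order → Run G ŵ w T order T′ →
                 weight w T′ ≤ weight (w⁺ order) T
  run-weight-≤ _               done          = ≤-refl
  run-weight-≤ (e∉rest ∷ uniq) (next st run) =
    ≤-trans (run-weight-≤ uniq run) (step-weight-≤ (λ e∈rest → All.lookup e∉rest e∈rest refl) st)

  run-cost-≤ : ∀ {T₀ T order} → Unique order → Run G ŵ w T₀ order T →
               cost G w T ≤ cost G ŵ T₀ + cost G err T₀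
  run-cost-≤ {T₀} {T} {order} uniq run = begin
    cost G w T                    ≡⟨ weight≡sum w T ⟨
    weight w T                    ≤⟨ run-weight-≤ uniq run ⟩
    weight (w⁺ order) T₀          ≤⟨ weight-mono (w⁺≤ŵ+err order) T₀ ⟩
    weight (λ e → ŵ e + err e) T₀ ≡⟨ weight-+ ŵ err T₀ ⟩
    weight ŵ T₀ + weight err T₀   ≡⟨ cong₂ _+_ (weight≡sum ŵ T₀) (weight≡sum err T₀) ⟩
    cost G ŵ T₀ + cost G err T₀   ∎

mainTheorem5 : ∀ {n m} (G : Graph n m) → Connected G →
    (ŵ w : Fin m → ℚ) → (∀ e → Positive (ŵ e)) → (∀ e → Positive (w e)) →
    (order : List (Fin m)) → order ↭ allFin m →
    (T₀ : Subset m) → IsMinSpanningTree G ŵ T₀ →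
    (T : Subset m) → Run G ŵ w T₀ order T →
    (Tₒ : Subset m) → IsMinSpanningTree G w Tₒ →
    cost G w T ≤ cost G w Tₒ + (1ℚ + 1ℚ) * eta G ŵ w
mainTheorem5 {m = m} G _ ŵ w _ _ order order↭allFin T₀ (T₀-tree , T₀-minimal) T run Tₒ (Tₒ-tree , _) =
  begin
    cost G w T                                 ≤⟨ run-cost-≤ G ŵ w order-unique run ⟩
    cost G ŵ T₀ + cost G p T₀                  ≤⟨ +-monoˡ-≤ _ (T₀-minimal Tₒ Tₒ-tree) ⟩
    cost G ŵ Tₒ + cost G p T₀                  ≤⟨ +-monoˡ-≤ _ (cost-ŵ≤cost-w+err G ŵ w Tₒ) ⟩
    (cost G w Tₒ + cost G p Tₒ) + cost G p T₀  ≤⟨ +-mono-≤ (+-monoʳ-≤ (cost G w Tₒ) (p-bound Tₒ-tree)) (p-bound T₀-tree) ⟩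
    (cost G w Tₒ + η) + η                      ≡⟨ solve 2 (λ c η → (c :+ η) :+ η := c :+ (con 1ℚ :+ con 1ℚ) :* η)
                                                          refl (cost G w Tₒ) η ⟩
    cost G w Tₒ + (1ℚ + 1ℚ) * η                ∎
  where
  open ≤-Reasoning
  open +-*-Solver
  η : ℚ
  η = eta G ŵ w
  p : Fin m → ℚ
  p = err G ŵ w
  p-bound : ∀ {S} → SpanningTree G S → cost G p S ≤ η
  p-bound = cost-err≤eta G ŵ w ∘ proj₂
  order-unique : Unique order
  order-unique = Permutation.Unique-resp-↭ (setoid (Fin m)) (↭⇒↭ₛ (↭-sym order↭allFin)) (allFin⁺ m)
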